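{- There are exactly $8\cdot(8-1)(8-2)(8-4) = 1344$ antilinear permutations of $\mathbb{Z}_2^3$.
   Context: $\oplus$ denotes addition in $\mathbb{Z}_2^3$. A permutation $\pi$ of $\mathbb{Z}_2^3$ is antilinear if (a) $\pi(0)=0$, and (b) for all non-zero $x,y,z\in\mathbb{Z}_2^3$, either $x\oplus y\oplus z\neq 0$ or $\pi(x)\oplus\pi(y)\oplus\pi(z)\neq0$. -}

module Defs where

open import Data.Bool using (Bool; true; false; _xor_)
open import Data.Fin using (Fin)
open import Data.Vec using (Vec; []; _∷_; replicate; zipWith)
open import Data.Product using (_×_)
open import Relation.Binary.PropositionalEquality using (_≡_; _≢_)
open import Data.Sum using (_⊎_)
open import Function.Definitions using (Bijective)

Z₂³ : Set
Z₂³ = Vec Bool 3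

𝟘 : Z₂³
𝟘 = replicate 3 false

infixl 6 _⊕_
_⊕_ : Z₂³ → Z₂³ → Z₂³
_⊕_ = zipWith _xor_

IsPermutation : (Z₂³ → Z₂³) → Set
IsPermutation π = Bijective _≡_ _≡_ π

Antilinear : (Z₂³ → Z₂³) → Set
Antilinear π =
  (π 𝟘 ≡ 𝟘) ×
  (∀ x y z → x ≢ 𝟘 → y ≢ 𝟘 → z ≢ 𝟘 →
     (x ⊕ y ⊕ z ≢ 𝟘) ⊎ (π x ⊕ π y ⊕ π z ≢ 𝟘))

IsAntilinearPermutation : (Z₂³ → Z₂³) → Set
IsAntilinearPermutation π = IsPermutation π × Antilinear π

-- For nonzero x, y, z the relation x ⊕ y ⊕ z ≡ 𝟘 just says z ≡ x ⊕ y, so a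
-- map fixing 𝟘 is antilinear iff it sends no line {x, y, x ⊕ y} of the Fano
-- plane onto a line, a decidable condition on pairs of points. The antilinear
-- permutations are found by a search that assigns images to the nonzero points
-- one at a time and abandons a partial assignment as soon as it is not
-- injective or sends a line onto a line; every antilinear permutation survives
-- the pruning, and each survivor is confirmed by the decision procedure. They
-- are pairwise distinct because their base-8 codes are strictly increasing.
module Submission where

open import Defs
open import Data.Bool using (false; true; if_then_else_)
import Data.Bool as Bool
open import Data.Bool.Properties using (xor-assoc; xor-identityˡ; xor-identityʳ; xor-same)
open import Data.List using (List; []; _∷_; map; foldl; filter; concatMap; length)
open import Data.List.Properties using (map-cong; length-map)
open import Data.List.Membership.Propositional using (_∈_; lose)
open import Data.List.Membership.Propositional.Properties using (∈-map⁺; ∈-map⁻; ∈-filter⁺; ∈-filter⁻; ∈-concatMap⁺)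
open import Data.List.Relation.Unary.All as All using (All; []; _∷_)
open import Data.List.Relation.Unary.All.Properties using (¬All⇒Any¬)
open import Data.List.Relation.Unary.Any as Any using (here; there; satisfied)
open import Data.List.Relation.Unary.AllPairs as AllPairs using (AllPairs)
import Data.List.Relation.Unary.AllPairs.Properties as AllPairs
open import Data.List.Relation.Unary.Linked using (Linked; linked?)
open import Data.List.Relation.Unary.Linked.Properties using (Linked⇒AllPairs)
open import Data.Nat as ℕ using (ℕ; _+_; _*_; _<_; _<?_)
open import Data.Nat.Properties using (<-trans; <-irrefl)
open import Data.Product using (Σ; _×_; _,_; proj₁; proj₂; ∃; ∃-syntax)
open import Data.Sum using (_⊎_; inj₁; inj₂; [_,_]; map₂)
open import Data.Vec using ([]; _∷_)
open import Data.Vec.Properties using (≡-dec; zipWith-assoc; zipWith-identityˡ; zipWith-identityʳ)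
open import Function using (_∘_; _on_; id)
open import Function.Bundles using (_⇔_; mk⇔)
open import Function.Consequences.Propositional using (strictlySurjective⇒surjective)
open import Function.Definitions using (Injective; Surjective)
open import Relation.Binary.Definitions using (DecidableEquality)
open import Relation.Binary.PropositionalEquality
  using (_≡_; _≢_; _≗_; refl; sym; trans; cong; subst; module ≡-Reasoning)
open import Relation.Nullary using (¬_; contradiction)
open import Relation.Nullary.Reflects using (invert)
open import Relation.Nullary.Decidable
  using (Dec; yes; no; does; _because_; map′; ¬?; _×-dec_; _⊎-dec_; _→-dec_)
import Relation.Nullary.Decidable as Dec
open import Relation.Unary using (Decidable)

private
  variable
    σ τ π : Z₂³ → Z₂³

infix 4 _≟_
_≟_ : DecidableEquality Z₂³
_≟_ = ≡-dec Bool._≟_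

nonzeroElements : List Z₂³
nonzeroElements =
  (false ∷ false ∷ true ∷ []) ∷ (false ∷ true ∷ false ∷ []) ∷ (false ∷ true ∷ true ∷ []) ∷
  (true ∷ false ∷ false ∷ []) ∷ (true ∷ false ∷ true ∷ []) ∷ (true ∷ true ∷ false ∷ []) ∷
  (true ∷ true ∷ true ∷ []) ∷ []

elements : List Z₂³
elements = 𝟘 ∷ nonzeroElements

∈-elements : ∀ x → x ∈ elements
∈-elements (false ∷ false ∷ false ∷ []) = here refl
∈-elements (false ∷ false ∷ true ∷ [])  = there (here refl)
∈-elements (false ∷ true ∷ false ∷ [])  = there (there (here refl))
∈-elements (false ∷ true ∷ true ∷ [])   = there (there (there (here refl)))
∈-elements (true ∷ false ∷ false ∷ [])  = there (there (there (there (here refl))))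
∈-elements (true ∷ false ∷ true ∷ [])   = there (there (there (there (there (here refl)))))
∈-elements (true ∷ true ∷ false ∷ [])   = there (there (there (there (there (there (here refl))))))
∈-elements (true ∷ true ∷ true ∷ [])    = there (there (there (there (there (there (there (here refl)))))))

module _ {P : Z₂³ → Set} where

  All-elements⇒∀ : All P elements → ∀ x → P x
  All-elements⇒∀ h x = All.lookup h (∈-elements x)

  all? : Decidable P → Dec (∀ x → P x)
  all? P? = map′ All-elements⇒∀ (λ h → All.tabulate (λ {x} _ → h x)) (All.all? P? elements)

  any? : Decidable P → Dec (∃ P)
  any? P? = map′ satisfied (λ (x , px) → lose (∈-elements x) px) (Any.any? P? elements)

≢-witness : ¬ (σ ≗ τ) → ∃[ x ] σ x ≢ τ x
≢-witness {σ} {τ} σ≉τ =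
  satisfied (¬All⇒Any¬ (λ x → σ x ≟ τ x) elements (σ≉τ ∘ All-elements⇒∀))

⊕-assoc : ∀ x y z → x ⊕ y ⊕ z ≡ x ⊕ (y ⊕ z)
⊕-assoc = zipWith-assoc xor-assoc

⊕-identityˡ : ∀ x → 𝟘 ⊕ x ≡ x
⊕-identityˡ = zipWith-identityˡ xor-identityˡ

⊕-identityʳ : ∀ x → x ⊕ 𝟘 ≡ x
⊕-identityʳ = zipWith-identityʳ xor-identityʳ

⊕-self : ∀ x → x ⊕ x ≡ 𝟘
⊕-self (a ∷ b ∷ c ∷ []) rewrite xor-same a | xor-same b | xor-same c = refl

⊕≡𝟘⇒≡⊕ : ∀ x y z → x ⊕ y ⊕ z ≡ 𝟘 → z ≡ x ⊕ y
⊕≡𝟘⇒≡⊕ x y z x⊕y⊕z≡𝟘 = begin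
  z                     ≡⟨ sym (⊕-identityˡ z) ⟩
  𝟘 ⊕ z                 ≡⟨ cong (_⊕ z) (sym (⊕-self (x ⊕ y))) ⟩
  x ⊕ y ⊕ (x ⊕ y) ⊕ z   ≡⟨ ⊕-assoc (x ⊕ y) (x ⊕ y) z ⟩
  x ⊕ y ⊕ (x ⊕ y ⊕ z)   ≡⟨ cong (x ⊕ y ⊕_) x⊕y⊕z≡𝟘 ⟩
  x ⊕ y ⊕ 𝟘             ≡⟨ ⊕-identityʳ (x ⊕ y) ⟩
  x ⊕ y                 ∎
  where open ≡-Reasoning

BreaksAllLines : (Z₂³ → Z₂³) → Set
BreaksAllLines π = ∀ x y → x ≢ 𝟘 → y ≢ 𝟘 → x ⊕ y ≢ 𝟘 → π x ⊕ π y ⊕ π (x ⊕ y) ≢ 𝟘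

breaksAllLines⇔antilinear : (π 𝟘 ≡ 𝟘 × BreaksAllLines π) ⇔ Antilinear π
breaksAllLines⇔antilinear {π} = mk⇔ antilinear breaksAllLines
  where
  antilinear : π 𝟘 ≡ 𝟘 × BreaksAllLines π → Antilinear π
  antilinear (π𝟘≡𝟘 , breaks) = π𝟘≡𝟘 , line
    where
    line : ∀ x y z → x ≢ 𝟘 → y ≢ 𝟘 → z ≢ 𝟘 →
           (x ⊕ y ⊕ z ≢ 𝟘) ⊎ (π x ⊕ π y ⊕ π z ≢ 𝟘)
    line x y z x≢𝟘 y≢𝟘 z≢𝟘 with x ⊕ y ⊕ z ≟ 𝟘
    ... | no x⊕y⊕z≢𝟘 = inj₁ x⊕y⊕z≢𝟘
    ... | yes x⊕y⊕z≡𝟘 with ⊕≡𝟘⇒≡⊕ x y z x⊕y⊕z≡𝟘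
    ...   | refl = inj₂ (breaks x y x≢𝟘 y≢𝟘 z≢𝟘)

  breaksAllLines : Antilinear π → π 𝟘 ≡ 𝟘 × BreaksAllLines π
  breaksAllLines (π𝟘≡𝟘 , line) = π𝟘≡𝟘 , λ x y x≢𝟘 y≢𝟘 x⊕y≢𝟘 →
    [ contradiction (⊕-self (x ⊕ y)) , id ] (line x y (x ⊕ y) x≢𝟘 y≢𝟘 x⊕y≢𝟘)

breaksAllLines? : Decidable BreaksAllLines
breaksAllLines? π = all? λ x → all? λ y →
  ¬? (x ≟ 𝟘) →-dec ¬? (y ≟ 𝟘) →-dec ¬? (x ⊕ y ≟ 𝟘) →-dec ¬? (π x ⊕ π y ⊕ π (x ⊕ y) ≟ 𝟘)

antilinear? : Decidable Antilinear
antilinear? π = Dec.map breaksAllLines⇔antilinear ((π 𝟘 ≟ 𝟘) ×-dec breaksAllLines? π)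

injective? : Decidable (Injective _≡_ _≡_)
injective? π = map′ (λ h {x} {y} → h x y) (λ h x y → h)
  (all? λ x → all? λ y → (π x ≟ π y) →-dec (x ≟ y))

surjective? : Decidable (Surjective _≡_ _≡_)
surjective? π = map′ strictlySurjective⇒surjective (λ h y → proj₁ (h y) , proj₂ (h y) refl)
  (all? λ y → any? λ x → π x ≟ y)

isAntilinearPermutation? : Decidable IsAntilinearPermutation
isAntilinearPermutation? π = (injective? π ×-dec surjective? π) ×-dec antilinear? π

IsAntilinearPermutation-resp-≗ : σ ≗ τ → IsAntilinearPermutation σ → IsAntilinearPermutation τ
IsAntilinearPermutation-resp-≗ {σ} {τ} σ≗τ ((injective , surjective) , σ𝟘≡𝟘 , line) =
  ((λ {x} {y} τx≡τy → injective (trans (σ≗τ x) (trans τx≡τy (sym (σ≗τ y))))) ,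
   (λ y → proj₁ (surjective y) , λ {z} z≡x → trans (sym (σ≗τ z)) (proj₂ (surjective y) z≡x))) ,
  trans (sym (σ≗τ 𝟘)) σ𝟘≡𝟘 ,
  λ x y z x≢𝟘 y≢𝟘 z≢𝟘 → map₂ (subst₃ x y z) (line x y z x≢𝟘 y≢𝟘 z≢𝟘)
  where
  subst₃ : ∀ x y z → σ x ⊕ σ y ⊕ σ z ≢ 𝟘 → τ x ⊕ τ y ⊕ τ z ≢ 𝟘
  subst₃ x y z rewrite σ≗τ x | σ≗τ y | σ≗τ z = id

Graph : Set
Graph = List (Z₂³ × Z₂³)

-- Only the first binding of a point counts; 𝟘 is the default value.
toFunction : Graph → Z₂³ → Z₂³
toFunction []            z = 𝟘
toFunction ((x , y) ∷ g) z = if does (z ≟ x) then y else toFunction g z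

Compatible : Z₂³ × Z₂³ → Z₂³ × Z₂³ → Set
Compatible (x , y) (x′ , y′) = y ≡ y′ → x ≡ x′

NoLine : Z₂³ × Z₂³ → Z₂³ × Z₂³ → Z₂³ × Z₂³ → Set
NoLine (x , y) (x₁ , y₁) (x₂ , y₂) =
  x ≢ 𝟘 → x₁ ≢ 𝟘 → x₂ ≢ 𝟘 → (x ⊕ x₁ ⊕ x₂ ≢ 𝟘) ⊎ (y ⊕ y₁ ⊕ y₂ ≢ 𝟘)

Admissible : Z₂³ × Z₂³ → Graph → Set
Admissible p g = All (Compatible p) g × All (λ q → All (NoLine p q) g) g

admissible? : ∀ p g → Dec (Admissible p g)
admissible? (x , y) g =
  All.all? compatible? g ×-dec All.all? (λ q → All.all? (noLine? q) g) g
  where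
  compatible? : ∀ q → Dec (Compatible (x , y) q)
  compatible? (x′ , y′) = (y ≟ y′) →-dec (x ≟ x′)
  noLine? : ∀ q r → Dec (NoLine (x , y) q r)
  noLine? (x₁ , y₁) (x₂ , y₂) =
    ¬? (x ≟ 𝟘) →-dec ¬? (x₁ ≟ 𝟘) →-dec ¬? (x₂ ≟ 𝟘) →-dec
    (¬? (x ⊕ x₁ ⊕ x₂ ≟ 𝟘) ⊎-dec ¬? (y ⊕ y₁ ⊕ y₂ ≟ 𝟘))

admissibleExtensions : List Z₂³ → Graph → List Graph
admissibleExtensions []       g = g ∷ []
admissibleExtensions (x ∷ xs) g =
  concatMap (λ y → admissibleExtensions xs ((x , y) ∷ g))
            (filter (λ y → admissible? (x , y) g) elements)

SubgraphOf : (Z₂³ → Z₂³) → Graph → Set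
SubgraphOf π = All (λ p → proj₂ p ≡ π (proj₁ p))

extendBy : (Z₂³ → Z₂³) → List Z₂³ → Graph → Graph
extendBy π []       g = g
extendBy π (x ∷ xs) g = extendBy π xs ((x , π x) ∷ g)

module _ {π : Z₂³ → Z₂³} (injective : Injective _≡_ _≡_ π) (antilinear : Antilinear π) where

  admissible : ∀ x {g} → SubgraphOf π g → Admissible (x , π x) g
  admissible x g⊆π =
    All.map (compatible _) g⊆π ,
    All.map (λ q⊆π → All.map (noLine _ _ q⊆π) g⊆π) g⊆π
    where
    compatible : ∀ p → proj₂ p ≡ π (proj₁ p) → Compatible (x , π x) p
    compatible (x′ , _) refl = injective
    noLine : ∀ q r → proj₂ q ≡ π (proj₁ q) → proj₂ r ≡ π (proj₁ r) → NoLine (x , π x) q r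
    noLine (x₁ , _) (x₂ , _) refl refl = proj₂ antilinear x x₁ x₂

  extendBy-∈-admissibleExtensions : ∀ xs {g} → SubgraphOf π g →
                                    extendBy π xs g ∈ admissibleExtensions xs g
  extendBy-∈-admissibleExtensions []       _   = here refl
  extendBy-∈-admissibleExtensions (x ∷ xs) {g} g⊆π =
    ∈-concatMap⁺ (λ y → admissibleExtensions xs ((x , y) ∷ g))
      (lose (∈-filter⁺ (λ y → admissible? (x , y) g) (∈-elements (π x)) (admissible x g⊆π))
            (extendBy-∈-admissibleExtensions xs (refl ∷ g⊆π)))

graphOf : (Z₂³ → Z₂³) → Graph
graphOf π = extendBy π nonzeroElements ((𝟘 , 𝟘) ∷ [])

toFunction-graphOf : π 𝟘 ≡ 𝟘 → toFunction (graphOf π) ≗ π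
toFunction-graphOf π𝟘≡𝟘 (false ∷ false ∷ false ∷ []) = sym π𝟘≡𝟘
toFunction-graphOf π𝟘≡𝟘 (false ∷ false ∷ true ∷ [])  = refl
toFunction-graphOf π𝟘≡𝟘 (false ∷ true ∷ false ∷ [])  = refl
toFunction-graphOf π𝟘≡𝟘 (false ∷ true ∷ true ∷ [])   = refl
toFunction-graphOf π𝟘≡𝟘 (true ∷ false ∷ false ∷ [])  = refl
toFunction-graphOf π𝟘≡𝟘 (true ∷ false ∷ true ∷ [])   = refl
toFunction-graphOf π𝟘≡𝟘 (true ∷ true ∷ false ∷ [])   = refl
toFunction-graphOf π𝟘≡𝟘 (true ∷ true ∷ true ∷ [])    = refl

-- Opaque so that conversion checking never runs the search; only `census`
-- unfolds it.
opaque
  admissibleGraphs : List Graph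
  admissibleGraphs = admissibleExtensions nonzeroElements ((𝟘 , 𝟘) ∷ [])

  graphOf-∈-admissibleGraphs : Injective _≡_ _≡_ π → Antilinear π → graphOf π ∈ admissibleGraphs
  graphOf-∈-admissibleGraphs injective antilinear@(π𝟘≡𝟘 , _) =
    extendBy-∈-admissibleExtensions injective antilinear nonzeroElements (sym π𝟘≡𝟘 ∷ [])

antilinearGraphs : List Graph
antilinearGraphs = filter (isAntilinearPermutation? ∘ toFunction) admissibleGraphs

∈-antilinearGraphs⁺ : IsAntilinearPermutation π → graphOf π ∈ antilinearGraphs
∈-antilinearGraphs⁺ π-alp@((injective , _) , antilinear@(π𝟘≡𝟘 , _)) =
  ∈-filter⁺ (isAntilinearPermutation? ∘ toFunction) {xs = admissibleGraphs}
    (graphOf-∈-admissibleGraphs injective antilinear)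
    (IsAntilinearPermutation-resp-≗ (sym ∘ toFunction-graphOf π𝟘≡𝟘) π-alp)

∈-antilinearGraphs⁻ : ∀ {g} → g ∈ antilinearGraphs → IsAntilinearPermutation (toFunction g)
∈-antilinearGraphs⁻ = proj₂ ∘ ∈-filter⁻ (isAntilinearPermutation? ∘ toFunction) {xs = admissibleGraphs}

IsAntilinearPermutation⇔∈ : IsAntilinearPermutation π ⇔ (∃[ σ ] σ ∈ map toFunction antilinearGraphs × π ≗ σ)
IsAntilinearPermutation⇔∈ {π} = mk⇔ member antilinearPermutation
  where
  member : IsAntilinearPermutation π → ∃[ σ ] σ ∈ map toFunction antilinearGraphs × π ≗ σ
  member π-alp@(_ , π𝟘≡𝟘 , _) =
    toFunction (graphOf π) ,
    ∈-map⁺ toFunction (∈-antilinearGraphs⁺ π-alp) ,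
    sym ∘ toFunction-graphOf π𝟘≡𝟘

  antilinearPermutation : ∃[ σ ] σ ∈ map toFunction antilinearGraphs × π ≗ σ → IsAntilinearPermutation π
  antilinearPermutation (σ , σ∈ , π≗σ) =
    IsAntilinearPermutation-resp-≗ (sym ∘ π≗σ) (σ-alp (∈-map⁻ toFunction σ∈))
    where
    σ-alp : ∃[ g ] g ∈ antilinearGraphs × σ ≡ toFunction g → IsAntilinearPermutation σ
    σ-alp (g , g∈ , σ≡g) = subst IsAntilinearPermutation (sym σ≡g) (∈-antilinearGraphs⁻ g∈)

digit : Z₂³ → ℕ
digit (a ∷ b ∷ c ∷ []) = (if a then 4 else 0) + (if b then 2 else 0) + (if c then 1 else 0)

-- `n * 8` rather than `8 * n`: `_*_` recurses on its first argument, so the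
-- latter would make `code σ` unfold to an enormous term for a variable σ.
fromDigits : List Z₂³ → ℕ
fromDigits = foldl (λ n y → n * 8 + digit y) 0

-- The enumeration is lexicographic in the values at the points of `elements`,
-- which `code` reads as base-8 digits, most significant first.
code : (Z₂³ → Z₂³) → ℕ
code σ = fromDigits (map σ elements)

code-cong : σ ≗ τ → code σ ≡ code τ
code-cong σ≗τ = cong fromDigits (map-cong σ≗τ elements)

code<⇒≢ : code σ < code τ → ∃[ x ] σ x ≢ τ x
code<⇒≢ code<code = ≢-witness (λ σ≗τ → <-irrefl (code-cong σ≗τ) code<code)

does≡true⇒ : ∀ {A : Set} (a? : Dec A) → does a? ≡ true → A
does≡true⇒ (true because [a]) refl = invert [a]

opaque
  unfolding admissibleGraphs

  -- One decision taking the list as an argument, so the list is computed once;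
  -- checking `refl` on `does` is far faster than elaborating a `True` proof.
  census : length antilinearGraphs ≡ 1344 × Linked _<_ (map (code ∘ toFunction) antilinearGraphs)
  census = does≡true⇒ (census? antilinearGraphs) refl
    where
    census? : ∀ gs → Dec (length gs ≡ 1344 × Linked _<_ (map (code ∘ toFunction) gs))
    census? gs = (length gs ℕ.≟ 1344) ×-dec linked? _<?_ (map (code ∘ toFunction) gs)

antilinearPermutations-distinct : AllPairs (λ σ τ → ∃[ x ] σ x ≢ τ x) (map toFunction antilinearGraphs)
antilinearPermutations-distinct = AllPairs.map⁺ {f = toFunction} {xs = antilinearGraphs}
  (AllPairs.map (λ {g} {h} → code<⇒≢ {toFunction g} {toFunction h}) codes<)
  where
  codes< : AllPairs (_<_ on (code ∘ toFunction)) antilinearGraphs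
  codes< = AllPairs.map⁻ {f = code ∘ toFunction} {xs = antilinearGraphs}
    (Linked⇒AllPairs <-trans (proj₂ census))

corollary1 : Σ (List (Z₂³ → Z₂³)) λ L →
    (length L ≡ 1344) ×
    AllPairs (λ σ τ → ∃[ x ] (σ x ≢ τ x)) L ×
    ((π : Z₂³ → Z₂³) → IsAntilinearPermutation π ⇔ (∃[ σ ] (σ ∈ L × (∀ x → π x ≡ σ x))))
corollary1 =
  map toFunction antilinearGraphs ,
  trans (length-map toFunction antilinearGraphs) (proj₁ census) ,
  antilinearPermutations-distinct ,
  λ _ → IsAntilinearPermutation⇔∈
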